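{- Let $K_n$ be the complete graph on $n$ vertices. For any positive integer $k\le n$, $$\lambda_e^k(K_n)=\begin{cases}0 & \text{if } k\ge n,\\ \binom{n}{2}-\lfloor n/2\rfloor k & \text{if } k<n.\end{cases}$$
   Context: Let $\lambda(G)$ denote the chromatic index of a simple graph $G$ (the minimum number of colors in a proper edge coloring). For a positive integer $k$ and a graph $G=(V,E)$, a set $E'\subseteq E$ is a $k$-chromatic index edge removal set if $\lambda(G-E')\le k$. The parameter $\lambda_e^k(G)$ is the minimum of $|E'|$ over all $k$-chromatic index edge removal sets $E'$. -}

module Defs where

open import Data.Nat using (ℕ; zero; suc; _+_; _<_; _≤_)
open import Data.Nat.Base using (_<ᵇ_)
open import Data.Bool using (Bool; true; false; _∧_; not; if_then_else_)
open import Data.Fin using (Fin; toℕ)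
open import Data.List using (List; map; allFin)
open import Data.Nat.ListAction using (sum)
open import Data.Product using (Σ; _×_; ∃)
open import Data.Sum using (_⊎_)
open import Relation.Binary.PropositionalEquality using (_≡_; _≢_)

-- A simple graph on vertex set Fin n, represented by its edge indicator on
-- ordered pairs (i , j) with toℕ i < toℕ j ("upper-triangular" representation).
-- Entries with toℕ i ≥ toℕ j are ignored everywhere.  Each unordered pair
-- {i, j} (i ≠ j) is represented exactly once, so loops/multi-edges cannot occur.
Graph : ℕ → Set
Graph n = Fin n → Fin n → Bool

Edge : ∀ {n} → Graph n → Fin n → Fin n → Set
Edge G i j = (toℕ i < toℕ j) × (G i j ≡ true)

Adj : ∀ {n} → Graph n → Fin n → Fin n → Set
Adj G i j = Edge G i j ⊎ Edge G j i

edgeCount : ∀ {n} → Graph n → ℕ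
edgeCount {n} G =
  sum (map (λ i → sum (map (λ j → if (toℕ i <ᵇ toℕ j) ∧ G i j then 1 else 0)
                           (allFin n)))
           (allFin n))

K : (n : ℕ) → Graph n
K n i j = true

record ProperEdgeColoring {n} (G : Graph n) (k : ℕ) : Set where
  field
    c      : Fin n → Fin n → Fin k
    sym    : ∀ i j → Adj G i j → c i j ≡ c j i
    proper : ∀ i j l → Adj G i j → Adj G i l → j ≢ l → c i j ≢ c i l

ChromaticIndexLe : ∀ {n} → Graph n → ℕ → Set
ChromaticIndexLe G k = ProperEdgeColoring G k

SubEdges : ∀ {n} → Graph n → Graph n → Set
SubEdges {n} E' G = ∀ (i j : Fin n) → Edge E' i j → Edge G i j

_─_ : ∀ {n} → Graph n → Graph n → Graph n
(G ─ E') i j = G i j ∧ not (E' i j)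

IsRemovalSet : ∀ {n} → ℕ → Graph n → Graph n → Set
IsRemovalSet k G E' = SubEdges E' G × ChromaticIndexLe (G ─ E') k

LambdaE≡ : ∀ {n} → Graph n → ℕ → ℕ → Set
LambdaE≡ {n} G k m =
  (Σ (Graph n) λ E' → IsRemovalSet k G E' × edgeCount E' ≡ m)
  × (∀ (E' : Graph n) → IsRemovalSet k G E' → m ≤ edgeCount E')

module Submission where

-- In a proper k-edge-colouring every colour class is a matching, which by the handshake
-- lemma has at most ⌊n/2⌋ edges; so at least C(n,2) − k⌊n/2⌋ edges of K n must be removed.
-- For the converse write n = M or n = M + 1 with M = 2t + 1 odd. The round-robin colouring
-- of K (M + 1) with M colours is a 1-factorisation, i.e. every colour class is a perfect
-- matching. Keeping the edges of the first k < n colours therefore leaves exactly k⌊n/2⌋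
-- edges of K n, since deleting the vertex M removes one edge of each colour; and if k ≥ n
-- then all M ≤ k colours may be kept.

open import Defs
open import Data.Nat using (ℕ; _≤_; _<_; _*_; _∸_; _/_)
open import Data.Nat.Combinatorics using (_C_)
open import Data.Product using (_×_)

open import Data.Nat.Base using (NonZero; zero; suc; _+_; z≤n; s≤s; _<ᵇ_; _≡ᵇ_; ⌊_/2⌋)
open import Data.Nat.Properties
open import Data.Nat.DivMod using (m/n≡1+[m∸n]/n; _mod_; m%n<n; m<n⇒m%n≡m)
open import Data.Nat.Combinatorics using (nC1≡n; nCk+nC[k+1]≡[n+1]C[k+1])
open import Data.Nat.ListAction using () renaming (sum to sumˡ)
open import Data.Nat.Tactic.RingSolver using (solve-∀)
open import Data.Bool.Base using (Bool; true; false; _∧_; _∨_; not; if_then_else_; T)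
open import Data.Bool.Properties using (∧-assoc; ∧-identityʳ; ∨-identityʳ; not-involutive; T-∧; T-≡)
open import Data.Fin.Base using (Fin; zero; suc; toℕ; fromℕ<; inject₁; fromℕ)
open import Data.Fin.Properties using (toℕ-injective; toℕ<n; toℕ-fromℕ<; toℕ-inject₁; toℕ-fromℕ)
import Data.Fin.Properties as Finₚ
open import Data.List.Base using (map; tabulate)
open import Data.Product using (_,_; proj₁; ∃-syntax)
open import Data.Sum using (_⊎_; inj₁; inj₂)
open import Data.Empty using (⊥-elim)
open import Function using (_∘_; Equivalence)
open import Relation.Nullary using (¬_; yes; no)
open import Relation.Nullary.Decidable using (decidable-stable)
open import Relation.Binary using (tri<; tri≈; tri>)
open import Relation.Binary.PropositionalEquality
  using (_≡_; _≢_; refl; sym; trans; cong; cong₂; subst; module ≡-Reasoning)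
open import Algebra.Properties.CommutativeMonoid.Sum +-0-commutativeMonoid
  using (sum-syntax; ∑-comm; ∑-distrib-+; sum-cong-≗; sum-init-last; sum-replicate-zero)

/2≡⌊/2⌋ : ∀ n → n / 2 ≡ ⌊ n /2⌋
/2≡⌊/2⌋ zero          = refl
/2≡⌊/2⌋ (suc zero)    = refl
/2≡⌊/2⌋ (suc (suc n)) = trans (m/n≡1+[m∸n]/n {suc (suc n)} (s≤s (s≤s z≤n))) (cong suc (/2≡⌊/2⌋ n))

double≤⇒≤/2 : ∀ {m n} → m + m ≤ n → m ≤ n / 2
double≤⇒≤/2 {m} {n} m+m≤n = begin
  m           ≡⟨ n≡⌊n+n/2⌋ m ⟩
  ⌊ m + m /2⌋ ≤⟨ ⌊n/2⌋-mono m+m≤n ⟩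
  ⌊ n /2⌋     ≡⟨ sym (/2≡⌊/2⌋ n) ⟩
  n / 2       ∎
  where open ≤-Reasoning

double-injective : ∀ {a b} → a + a ≡ b + b → a ≡ b
double-injective {a} {b} e = trans (n≡⌊n+n/2⌋ a) (trans (cong ⌊_/2⌋ e) (sym (n≡⌊n+n/2⌋ b)))

halves : ∀ a → ∃[ s ] (a ≡ s + s ⊎ a ≡ suc (s + s))
halves zero = zero , inj₁ refl
halves (suc a) with halves a
... | s , inj₁ a≡s+s = s , inj₂ (cong suc a≡s+s)
... | s , inj₂ a≡1+s+s = suc s , inj₁ (trans (cong suc a≡1+s+s) (sym (cong suc (+-suc s s))))

odd-or-even : ∀ {n} → 1 ≤ n → ∃[ t ] (n ≡ suc (t + t) ⊎ n ≡ suc (suc (t + t)))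
odd-or-even {n} 1≤n with halves n
... | zero  , inj₁ refl  = ⊥-elim (<⇒≱ 1≤n z≤n)
... | suc t , inj₁ refl  = t , inj₂ (cong suc (+-suc t t))
... | t     , inj₂ refl  = t , inj₁ refl

toℕ-mod : ∀ {m k} .{{_ : NonZero k}} → m < k → toℕ (m mod k) ≡ m
toℕ-mod {m} {k} m<k = trans (toℕ-fromℕ< (m%n<n m k)) (m<n⇒m%n≡m m<k)

≡true : ∀ {b} → T b → b ≡ true
≡true = Equivalence.to T-≡

≡false : ∀ {b} → ¬ T b → b ≡ false
≡false {false} _  = refl
≡false {true}  ¬b = ⊥-elim (¬b _)

≡ᵇ-refl : ∀ m → (m ≡ᵇ m) ≡ true
≡ᵇ-refl m = ≡true (≡⇒≡ᵇ m m refl)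

≡ᵇ-≢ : ∀ {m n} → m ≢ n → (m ≡ᵇ n) ≡ false
≡ᵇ-≢ {m} {n} m≢n = ≡false (m≢n ∘ ≡ᵇ⇒≡ m n)

≡ᵇ-sym : ∀ m n → (m ≡ᵇ n) ≡ (n ≡ᵇ m)
≡ᵇ-sym zero    zero    = refl
≡ᵇ-sym zero    (suc n) = refl
≡ᵇ-sym (suc m) zero    = refl
≡ᵇ-sym (suc m) (suc n) = ≡ᵇ-sym m n

𝟙 : Bool → ℕ
𝟙 b = if b then 1 else 0

𝟙-∨ : ∀ x y → (T x → ¬ T y) → 𝟙 (x ∨ y) ≡ 𝟙 x + 𝟙 y
𝟙-∨ true  true  disjoint = ⊥-elim (disjoint _ _)
𝟙-∨ true  false disjoint = refl
𝟙-∨ false y     disjoint = refl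

∑-const : ∀ n c → ∑[ i < n ] c ≡ n * c
∑-const zero    c = refl
∑-const (suc n) c = cong (c +_) (∑-const n c)

∑-one : ∀ n → ∑[ i < n ] 1 ≡ n
∑-one zero    = refl
∑-one (suc n) = cong suc (∑-one n)

∑-mono-≤ : ∀ {n} {f g : Fin n → ℕ} → (∀ i → f i ≤ g i) → ∑[ i < n ] f i ≤ ∑[ i < n ] g i
∑-mono-≤ {zero}  f≤g = z≤n
∑-mono-≤ {suc n} f≤g = +-mono-≤ (f≤g zero) (∑-mono-≤ (f≤g ∘ suc))

∑-≥-term : ∀ {n} (f : Fin n → ℕ) i → f i ≤ ∑[ j < n ] f j
∑-≥-term f zero    = m≤m+n _ _
∑-≥-term f (suc i) = ≤-trans (∑-≥-term (f ∘ suc) i) (m≤n+m _ _)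

∑-upTo-suc : ∀ m (f : ℕ → ℕ) → ∑[ j < suc m ] f (toℕ j) ≡ ∑[ j < m ] f (toℕ j) + f m
∑-upTo-suc m f = begin
  ∑[ j < suc m ] f (toℕ j)
    ≡⟨ sum-init-last (f ∘ toℕ) ⟩
  ∑[ j < m ] f (toℕ (inject₁ j)) + f (toℕ (fromℕ m))
    ≡⟨ cong₂ _+_ (sum-cong-≗ {m} (cong f ∘ toℕ-inject₁)) (cong f (toℕ-fromℕ m)) ⟩
  ∑[ j < m ] f (toℕ j) + f m ∎
  where open ≡-Reasoning

sumˡ-map-tabulate : ∀ {A : Set} n (f : A → ℕ) (g : Fin n → A) → sumˡ (map f (tabulate g)) ≡ ∑[ i < n ] f (g i)
sumˡ-map-tabulate zero    f g = refl
sumˡ-map-tabulate (suc n) f g = cong (f (g zero) +_) (sumˡ-map-tabulate n f (g ∘ suc))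

count-none : ∀ {n} (p : Fin n → Bool) → (∀ i → ¬ T (p i)) → ∑[ i < n ] 𝟙 (p i) ≡ 0
count-none {zero}  p none = refl
count-none {suc n} p none with p zero in eq
... | true  = ⊥-elim (none zero (subst T (sym eq) _))
... | false = count-none (p ∘ suc) (none ∘ suc)

count-≤1 : ∀ {n} (p : Fin n → Bool) → (∀ i j → T (p i) → T (p j) → i ≡ j) → ∑[ i < n ] 𝟙 (p i) ≤ 1
count-≤1 {zero}  p unique = z≤n
count-≤1 {suc n} p unique with p zero in eq
... | false = count-≤1 (p ∘ suc) (λ i j pi pj → Finₚ.suc-injective (unique _ _ pi pj))
... | true  = ≤-reflexive (cong suc (count-none (p ∘ suc) (λ i pi → 0≢suc (unique _ _ (subst T (sym eq) _) pi))))
  where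
  0≢suc : ∀ {i : Fin n} → zero ≢ suc i
  0≢suc ()

count-≡1 : ∀ {n} (p : Fin n → Bool) → (∀ i j → T (p i) → T (p j) → i ≡ j) →
           ∀ w → T (p w) → ∑[ i < n ] 𝟙 (p i) ≡ 1
count-≡1 p unique w pw = ≤-antisym (count-≤1 p unique) (≤-trans (𝟙-T pw) (∑-≥-term (𝟙 ∘ p) w))
  where
  𝟙-T : ∀ {b} → T b → 1 ≤ 𝟙 b
  𝟙-T {true} _ = ≤-refl

count-≡ᵇ-below : ∀ k v → ∑[ a < k ] 𝟙 (v ≡ᵇ toℕ a) ≡ 𝟙 (v <ᵇ k)
count-≡ᵇ-below zero    v       = refl
count-≡ᵇ-below (suc k) zero    = cong suc (sum-replicate-zero k)
count-≡ᵇ-below (suc k) (suc v) = count-≡ᵇ-below k v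

𝟙-∧-<ᵇ-split : ∀ k b v → 𝟙 (b ∧ (v <ᵇ k)) ≡ ∑[ a < k ] 𝟙 (b ∧ (v ≡ᵇ toℕ a))
𝟙-∧-<ᵇ-split k false v = sym (sum-replicate-zero k)
𝟙-∧-<ᵇ-split k true  v = sym (count-≡ᵇ-below k v)

-- Edge counts and the handshake lemma
edgeᵇ : ∀ {n} → Graph n → Fin n → Fin n → Bool
edgeᵇ G i j = (toℕ i <ᵇ toℕ j) ∧ G i j

adjᵇ : ∀ {n} → Graph n → Fin n → Fin n → Bool
adjᵇ G i j = edgeᵇ G i j ∨ edgeᵇ G j i

degree : ∀ {n} → Graph n → Fin n → ℕ
degree {n} G i = ∑[ j < n ] 𝟙 (adjᵇ G i j)

edgeᵇ⇒Edge : ∀ {n} (G : Graph n) {i j} → T (edgeᵇ G i j) → Edge G i j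
edgeᵇ⇒Edge G {i} {j} e with Equivalence.to T-∧ e
... | i<j , Gij = <ᵇ⇒< (toℕ i) (toℕ j) i<j , ≡true Gij

adjᵇ⇒Adj : ∀ {n} (G : Graph n) {i j} → T (adjᵇ G i j) → Adj G i j
adjᵇ⇒Adj G {i} {j} a with edgeᵇ G i j in eq
... | true  = inj₁ (edgeᵇ⇒Edge G (subst T (sym eq) _))
... | false = inj₂ (edgeᵇ⇒Edge G a)

Adj⇒≢ : ∀ {n} {G : Graph n} {i j} → Adj G i j → toℕ i ≢ toℕ j
Adj⇒≢ (inj₁ (i<j , _)) = <⇒≢ i<j
Adj⇒≢ (inj₂ (j<i , _)) = <⇒≢ j<i ∘ sym

adjᵇ-symmetric : ∀ {n} (G : Graph n) → (∀ i j → G i j ≡ G j i) →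
                 ∀ i j → adjᵇ G i j ≡ not (toℕ i ≡ᵇ toℕ j) ∧ G i j
adjᵇ-symmetric G G-sym i j with <-cmp (toℕ i) (toℕ j)
... | tri< i<j _ _
  rewrite ≡true (<⇒<ᵇ i<j) | ≡false (<⇒≯ i<j ∘ <ᵇ⇒< (toℕ j) (toℕ i)) | ≡ᵇ-≢ (<⇒≢ i<j)
  = ∨-identityʳ (G i j)
... | tri> _ _ j<i
  rewrite ≡true (<⇒<ᵇ j<i) | ≡false (<⇒≯ j<i ∘ <ᵇ⇒< (toℕ i) (toℕ j)) | ≡ᵇ-≢ (<⇒≢ j<i ∘ sym)
  = G-sym j i
... | tri≈ _ i≡j _ with toℕ-injective i≡j
...   | refl rewrite ≡false (<-irrefl refl ∘ <ᵇ⇒< (toℕ i) (toℕ i)) | ≡ᵇ-refl (toℕ i) = refl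

edgeCount-∑ : ∀ {n} (G : Graph n) → edgeCount G ≡ ∑[ i < n ] ∑[ j < n ] 𝟙 (edgeᵇ G i j)
edgeCount-∑ {n} G = trans (sumˡ-map-tabulate n _ (λ i → i))
                          (sum-cong-≗ {n} (λ i → sumˡ-map-tabulate n _ (λ j → j)))

handshake : ∀ {n} (G : Graph n) → edgeCount G + edgeCount G ≡ ∑[ i < n ] degree G i
handshake {n} G = begin
  edgeCount G + edgeCount G
    ≡⟨ cong₂ _+_ (edgeCount-∑ G) (trans (edgeCount-∑ G) (∑-comm e)) ⟩
  ∑[ i < n ] ∑[ j < n ] e i j + ∑[ i < n ] ∑[ j < n ] e j i
    ≡⟨ sym (∑-distrib-+ (λ i → ∑[ j < n ] e i j) _) ⟩
  ∑[ i < n ] (∑[ j < n ] e i j + ∑[ j < n ] e j i)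
    ≡⟨ sum-cong-≗ {n} (λ i → sym (∑-distrib-+ (e i) _)) ⟩
  ∑[ i < n ] ∑[ j < n ] (e i j + e j i)
    ≡⟨ sum-cong-≗ {n} (λ i → sum-cong-≗ {n} (λ j → sym (𝟙-∨ _ _ (oneWay i j)))) ⟩
  ∑[ i < n ] degree G i ∎
  where
  open ≡-Reasoning
  e : Fin n → Fin n → ℕ
  e i j = 𝟙 (edgeᵇ G i j)
  oneWay : ∀ i j → T (edgeᵇ G i j) → ¬ T (edgeᵇ G j i)
  oneWay i j ij ji = <-asym (proj₁ (edgeᵇ⇒Edge G ij)) (proj₁ (edgeᵇ⇒Edge G ji))

edgeCount-K : ∀ n → edgeCount (K n) ≡ n C 2
edgeCount-K n = trans (edgeCount-∑ (K n)) (∑-edges-K n)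
  where
  ∑-edges-K : ∀ n → ∑[ i < n ] ∑[ j < n ] 𝟙 (edgeᵇ (K n) i j) ≡ n C 2
  ∑-edges-K zero    = refl
  ∑-edges-K (suc n) = begin
    ∑[ j < n ] 1 + ∑[ i < n ] ∑[ j < n ] 𝟙 (edgeᵇ (K n) i j) ≡⟨ cong₂ _+_ (∑-one n) (∑-edges-K n) ⟩
    n + n C 2                                               ≡⟨ cong (_+ n C 2) (sym (nC1≡n n)) ⟩
    n C 1 + n C 2                                           ≡⟨ nCk+nC[k+1]≡[n+1]C[k+1] n 1 ⟩
    suc n C 2                                               ∎
    where open ≡-Reasoning

edgeCount-complement : ∀ {n} (E' : Graph n) → edgeCount E' + edgeCount (K n ─ E') ≡ n C 2
edgeCount-complement {n} E' = begin
  edgeCount E' + edgeCount (K n ─ E')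
    ≡⟨ cong₂ _+_ (edgeCount-∑ E') (edgeCount-∑ (K n ─ E')) ⟩
  ∑[ i < n ] ∑[ j < n ] 𝟙 (edgeᵇ E' i j) + ∑[ i < n ] ∑[ j < n ] 𝟙 (edgeᵇ (K n ─ E') i j)
    ≡⟨ sym (∑-distrib-+ (λ i → ∑[ j < n ] 𝟙 (edgeᵇ E' i j)) _) ⟩
  ∑[ i < n ] (∑[ j < n ] 𝟙 (edgeᵇ E' i j) + ∑[ j < n ] 𝟙 (edgeᵇ (K n ─ E') i j))
    ≡⟨ sum-cong-≗ {n} (λ i → trans (sym (∑-distrib-+ (λ j → 𝟙 (edgeᵇ E' i j)) _))
                                   (sum-cong-≗ {n} (λ j → split (toℕ i <ᵇ toℕ j) (E' i j)))) ⟩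
  ∑[ i < n ] ∑[ j < n ] 𝟙 (edgeᵇ (K n) i j)
    ≡⟨ sym (edgeCount-∑ (K n)) ⟩
  edgeCount (K n)
    ≡⟨ edgeCount-K n ⟩
  n C 2 ∎
  where
  open ≡-Reasoning
  split : ∀ x y → 𝟙 (x ∧ y) + 𝟙 (x ∧ (true ∧ not y)) ≡ 𝟙 (x ∧ true)
  split false y     = refl
  split true  true  = refl
  split true  false = refl

-- K n ─ (λ _ _ → false) reduces to K n.
edgeCount-empty : ∀ n → edgeCount {n} (λ _ _ → false) ≡ 0
edgeCount-empty n = +-cancelʳ-≡ (edgeCount (K n)) _ 0 (trans (edgeCount-complement {n} (λ _ _ → false)) (sym (edgeCount-K n)))

-- Colour classes are matchings
colourClass : ∀ {n k} → Graph n → (Fin n → Fin n → Fin k) → Fin k → Graph n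
colourClass G c a i j = G i j ∧ (toℕ (c i j) ≡ᵇ toℕ a)

edgeCount-by-colour : ∀ {n k} (G : Graph n) (c : Fin n → Fin n → Fin k) →
                      edgeCount G ≡ ∑[ a < k ] edgeCount (colourClass G c a)
edgeCount-by-colour {n} {k} G c = begin
  edgeCount G                                             ≡⟨ edgeCount-∑ G ⟩
  ∑[ i < n ] ∑[ j < n ] 𝟙 (edgeᵇ G i j)                   ≡⟨ sum-cong-≗ {n} (λ i → sum-cong-≗ {n} (split i)) ⟩
  ∑[ i < n ] ∑[ j < n ] ∑[ a < k ] 𝟙 (edgeᵇ (colourClass G c a) i j)
                                                          ≡⟨ sum-cong-≗ {n} (λ i → ∑-comm {n} {k} _) ⟩
  ∑[ i < n ] ∑[ a < k ] ∑[ j < n ] 𝟙 (edgeᵇ (colourClass G c a) i j)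
                                                          ≡⟨ ∑-comm {n} {k} _ ⟩
  ∑[ a < k ] ∑[ i < n ] ∑[ j < n ] 𝟙 (edgeᵇ (colourClass G c a) i j)
                                                          ≡⟨ sum-cong-≗ {k} (λ a → sym (edgeCount-∑ (colourClass G c a))) ⟩
  ∑[ a < k ] edgeCount (colourClass G c a)                ∎
  where
  open ≡-Reasoning
  split : ∀ i j → 𝟙 (edgeᵇ G i j) ≡ ∑[ a < k ] 𝟙 (edgeᵇ (colourClass G c a) i j)
  split i j = begin
    𝟙 (edgeᵇ G i j)
      ≡⟨ cong 𝟙 (sym (∧-identityʳ _)) ⟩
    𝟙 (edgeᵇ G i j ∧ true)
      ≡⟨ cong (λ b → 𝟙 (edgeᵇ G i j ∧ b)) (sym (≡true (<⇒<ᵇ (toℕ<n (c i j))))) ⟩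
    𝟙 (edgeᵇ G i j ∧ (toℕ (c i j) <ᵇ k))
      ≡⟨ 𝟙-∧-<ᵇ-split k _ (toℕ (c i j)) ⟩
    ∑[ a < k ] 𝟙 (edgeᵇ G i j ∧ (toℕ (c i j) ≡ᵇ toℕ a))
      ≡⟨ sum-cong-≗ {k} (λ a → cong 𝟙 (∧-assoc (toℕ i <ᵇ toℕ j) _ _)) ⟩
    ∑[ a < k ] 𝟙 (edgeᵇ (colourClass G c a) i j) ∎

module _ {n k} {G : Graph n} (P : ProperEdgeColoring G k) where
  open ProperEdgeColoring P using (c; proper) renaming (sym to c-sym)

  Edge-colourClass : ∀ {a i j} → Edge (colourClass G c a) i j → Edge G i j × c i j ≡ a
  Edge-colourClass {a} {i} {j} (i<j , Gij∧cij≡a) with Equivalence.to T-∧ (Equivalence.from T-≡ Gij∧cij≡a)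
  ... | Gij , cij≡a = (i<j , ≡true Gij) , toℕ-injective (≡ᵇ⇒≡ (toℕ (c i j)) (toℕ a) cij≡a)

  Adj-colourClass : ∀ {a i j} → T (adjᵇ (colourClass G c a) i j) → Adj G i j × c i j ≡ a
  Adj-colourClass {a} {i} {j} adj with adjᵇ⇒Adj (colourClass G c a) adj
  ... | inj₁ eij = let (Eij , cij≡a) = Edge-colourClass eij in inj₁ Eij , cij≡a
  ... | inj₂ eji = let (Eji , cji≡a) = Edge-colourClass eji in inj₂ Eji , trans (c-sym i j (inj₂ Eji)) cji≡a

  degree-colourClass-≤1 : ∀ a i → degree (colourClass G c a) i ≤ 1
  degree-colourClass-≤1 a i = count-≤1 _ λ j l ij il →
    let (Aij , cij≡a) = Adj-colourClass ij
        (Ail , cil≡a) = Adj-colourClass il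
    in decidable-stable (j Finₚ.≟ l) (λ j≢l → proper i j l Aij Ail j≢l (trans cij≡a (sym cil≡a)))

  edgeCount-colourClass-≤ : ∀ a → edgeCount (colourClass G c a) ≤ n / 2
  edgeCount-colourClass-≤ a = double≤⇒≤/2 (begin
    edgeCount (colourClass G c a) + edgeCount (colourClass G c a) ≡⟨ handshake (colourClass G c a) ⟩
    ∑[ i < n ] degree (colourClass G c a) i                       ≤⟨ ∑-mono-≤ (degree-colourClass-≤1 a) ⟩
    ∑[ i < n ] 1                                                  ≡⟨ ∑-one n ⟩
    n                                                             ∎)
    where open ≤-Reasoning

  edgeCount-≤-colours : edgeCount G ≤ k * (n / 2)
  edgeCount-≤-colours = begin
    edgeCount G                              ≡⟨ edgeCount-by-colour G c ⟩
    ∑[ a < k ] edgeCount (colourClass G c a) ≤⟨ ∑-mono-≤ edgeCount-colourClass-≤ ⟩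
    ∑[ a < k ] (n / 2)                       ≡⟨ ∑-const k (n / 2) ⟩
    k * (n / 2)                              ∎
    where open ≤-Reasoning

removalSet-size-≥ : ∀ {n k} (E' : Graph n) → IsRemovalSet k (K n) E' → n C 2 ∸ (n / 2) * k ≤ edgeCount E'
removalSet-size-≥ {n} {k} E' (_ , colouring) = begin
  n C 2 ∸ (n / 2) * k
    ≤⟨ ∸-monoʳ-≤ (n C 2) (subst (edgeCount (K n ─ E') ≤_) (*-comm k (n / 2)) (edgeCount-≤-colours colouring)) ⟩
  n C 2 ∸ edgeCount (K n ─ E')
    ≡⟨ cong (_∸ edgeCount (K n ─ E')) (sym (edgeCount-complement E')) ⟩
  edgeCount E' + edgeCount (K n ─ E') ∸ edgeCount (K n ─ E')
    ≡⟨ m+n∸n≡m (edgeCount E') (edgeCount (K n ─ E')) ⟩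
  edgeCount E' ∎
  where open ≤-Reasoning

-- The round-robin 1-factorisation
module RoundRobin (t : ℕ) where

  M : ℕ
  M = suc (t + t)

  -- u mod M, for u < M + M
  reduce : ℕ → ℕ
  reduce u = if u <ᵇ M then u else u ∸ M

  reduce-cases : ∀ u → (u < M × reduce u ≡ u) ⊎ (M ≤ u × reduce u + M ≡ u)
  reduce-cases u with u <ᵇ M in eq
  ... | true  = inj₁ (<ᵇ⇒< u M (subst T (sym eq) _) , refl)
  ... | false = inj₂ (M≤u , m∸n+n≡m M≤u)
    where
    M≤u : M ≤ u
    M≤u = ≮⇒≥ (λ u<M → subst T eq (<⇒<ᵇ u<M))

  reduce-< : ∀ {u} → u < M + M → reduce u < M
  reduce-< {u} u<2M with reduce-cases u
  ... | inj₁ (u<M , ru≡u)  = subst (_< M) (sym ru≡u) u<M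
  ... | inj₂ (_ , ru+M≡u) = +-cancelʳ-< M _ M (subst (_< M + M) (sym ru+M≡u) u<2M)

  reduce-id : ∀ {u} → u < M → reduce u ≡ u
  reduce-id {u} u<M with reduce-cases u
  ... | inj₁ (_ , ru≡u)   = ru≡u
  ... | inj₂ (M≤u , _)    = ⊥-elim (<⇒≱ u<M M≤u)

  reduce-+M : ∀ {u} → u < M → reduce (u + M) ≡ u
  reduce-+M {u} u<M with reduce-cases (u + M)
  ... | inj₁ (u+M<M , _) = ⊥-elim (<⇒≱ u+M<M (m≤n+m M u))
  ... | inj₂ (_ , r+M≡u+M) = +-cancelʳ-≡ M _ u r+M≡u+M

  reduce-≡ : ∀ {u v} → reduce u ≡ reduce v → u ≡ v ⊎ u + M ≡ v ⊎ v + M ≡ u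
  reduce-≡ {u} {v} e with reduce-cases u | reduce-cases v
  ... | inj₁ (_ , ru≡u)   | inj₁ (_ , rv≡v)   = inj₁ (trans (sym ru≡u) (trans e rv≡v))
  ... | inj₂ (_ , ru+M≡u) | inj₂ (_ , rv+M≡v) = inj₁ (trans (sym ru+M≡u) (trans (cong (_+ M) e) rv+M≡v))
  ... | inj₁ (_ , ru≡u)   | inj₂ (_ , rv+M≡v) = inj₂ (inj₁ (trans (cong (_+ M) (trans (sym ru≡u) e)) rv+M≡v))
  ... | inj₂ (_ , ru+M≡u) | inj₁ (_ , rv≡v)   = inj₂ (inj₂ (trans (cong (_+ M) (trans (sym rv≡v) (sym e))) ru+M≡u))

  x+a+M≢x+b : ∀ x {a b} → b < M → x + a + M ≢ x + b
  x+a+M≢x+b x {a} {b} b<M e =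
    <⇒≱ b<M (subst (M ≤_) (+-cancelˡ-≡ x (a + M) b (trans (sym (+-assoc x a M)) e)) (m≤n+m M a))

  reduce-+-injective : ∀ x {a b} → a < M → b < M → reduce (x + a) ≡ reduce (x + b) → a ≡ b
  reduce-+-injective x {a} {b} a<M b<M e with reduce-≡ e
  ... | inj₁ x+a≡x+b          = +-cancelˡ-≡ x a b x+a≡x+b
  ... | inj₂ (inj₁ x+a+M≡x+b) = ⊥-elim (x+a+M≢x+b x b<M x+a+M≡x+b)
  ... | inj₂ (inj₂ x+b+M≡x+a) = ⊥-elim (x+a+M≢x+b x a<M x+b+M≡x+a)

  even+even+M≢even : ∀ a b → a + a + M ≢ b + b
  even+even+M≢even a b e = even≢odd b (a + t) (trans (twice b) (trans (sym e) (shift a t)))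
    where
    twice : ∀ b → 2 * b ≡ b + b
    twice = solve-∀
    shift : ∀ a t → a + a + suc (t + t) ≡ suc (2 * (a + t))
    shift = solve-∀

  reduce-double-injective : ∀ a b → reduce (a + a) ≡ reduce (b + b) → a ≡ b
  reduce-double-injective a b e with reduce-≡ e
  ... | inj₁ a+a≡b+b = double-injective a+a≡b+b
  ... | inj₂ (inj₁ a+a+M≡b+b) = ⊥-elim (even+even+M≢even a b a+a+M≡b+b)
  ... | inj₂ (inj₂ b+b+M≡a+a) = ⊥-elim (even+even+M≢even b a b+b+M≡a+a)

  -- Vertices x, y < M get colour x + y mod M; the extra vertex M is joined to x in the
  -- colour 2x mod M, the only colour that the other vertices leave missing at x.
  colour : ℕ → ℕ → ℕ
  colour x y = if x ≡ᵇ M then reduce (y + y) else if y ≡ᵇ M then reduce (x + x) else reduce (x + y)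

  colour-M : ∀ y → colour M y ≡ reduce (y + y)
  colour-M y rewrite ≡ᵇ-refl M = refl

  colour-x-M : ∀ {x} → x ≢ M → colour x M ≡ reduce (x + x)
  colour-x-M x≢M rewrite ≡ᵇ-≢ x≢M | ≡ᵇ-refl M = refl

  colour-x-y : ∀ {x y} → x ≢ M → y ≢ M → colour x y ≡ reduce (x + y)
  colour-x-y x≢M y≢M rewrite ≡ᵇ-≢ x≢M | ≡ᵇ-≢ y≢M = refl

  colour-sym : ∀ x y → colour x y ≡ colour y x
  colour-sym x y with x ≟ M | y ≟ M
  ... | yes refl | yes refl = refl
  ... | yes refl | no y≢M   = trans (colour-M y) (sym (colour-x-M y≢M))
  ... | no x≢M   | yes refl = trans (colour-x-M x≢M) (sym (colour-M x))
  ... | no x≢M   | no y≢M   = trans (colour-x-y x≢M y≢M) (trans (cong reduce (+-comm x y)) (sym (colour-x-y y≢M x≢M)))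

  colour-< : ∀ {x y} → x ≤ M → y ≤ M → x ≢ y → colour x y < M
  colour-< {x} {y} x≤M y≤M x≢y with m≤n⇒m<n∨m≡n x≤M | m≤n⇒m<n∨m≡n y≤M
  ... | inj₂ refl | inj₂ refl = ⊥-elim (x≢y refl)
  ... | inj₂ refl | inj₁ y<M  = subst (_< M) (sym (colour-M y)) (reduce-< (+-mono-< y<M y<M))
  ... | inj₁ x<M  | inj₂ refl = subst (_< M) (sym (colour-x-M (<⇒≢ x<M))) (reduce-< (+-mono-< x<M x<M))
  ... | inj₁ x<M  | inj₁ y<M  = subst (_< M) (sym (colour-x-y (<⇒≢ x<M) (<⇒≢ y<M))) (reduce-< (+-mono-< x<M y<M))

  colour-cancel : ∀ {x y z} → x ≤ M → y ≤ M → z ≤ M → x ≢ y → x ≢ z → colour x y ≡ colour x z → y ≡ z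
  colour-cancel {x} {y} {z} x≤M y≤M z≤M x≢y x≢z e
    with m≤n⇒m<n∨m≡n x≤M | m≤n⇒m<n∨m≡n y≤M | m≤n⇒m<n∨m≡n z≤M
  ... | inj₂ refl | inj₂ refl | _         = ⊥-elim (x≢y refl)
  ... | inj₂ refl | _         | inj₂ refl = ⊥-elim (x≢z refl)
  ... | inj₂ refl | inj₁ _    | inj₁ _    = reduce-double-injective y z (trans (sym (colour-M y)) (trans e (colour-M z)))
  ... | inj₁ _    | inj₂ refl | inj₂ refl = refl
  ... | inj₁ x<M  | inj₂ refl | inj₁ z<M  = ⊥-elim (x≢z (reduce-+-injective x x<M z<M
    (trans (sym (colour-x-M (<⇒≢ x<M))) (trans e (colour-x-y (<⇒≢ x<M) (<⇒≢ z<M))))))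
  ... | inj₁ x<M  | inj₁ y<M  | inj₂ refl = ⊥-elim (x≢y (reduce-+-injective x x<M y<M
    (trans (sym (colour-x-M (<⇒≢ x<M))) (trans (sym e) (colour-x-y (<⇒≢ x<M) (<⇒≢ y<M))))))
  ... | inj₁ x<M  | inj₁ y<M  | inj₁ z<M  = reduce-+-injective x y<M z<M
    (trans (sym (colour-x-y (<⇒≢ x<M) (<⇒≢ y<M))) (trans e (colour-x-y (<⇒≢ x<M) (<⇒≢ z<M))))

  halve : ∀ {a} → a < M → ∃[ y ] y < M × reduce (y + y) ≡ a
  halve {a} a<M with halves a
  ... | s , inj₁ refl = s , ≤-<-trans (m≤m+n s s) a<M , reduce-id a<M
  ... | s , inj₂ refl = suc (s + t) , y<M , trans (cong reduce (y+y≡a+M s t)) (reduce-+M a<M)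
    where
    s<t : s < t
    s<t = ≰⇒> (λ t≤s → <⇒≱ a<M (s≤s (+-mono-≤ t≤s t≤s)))
    y<M : suc (s + t) < M
    y<M = s≤s (+-monoˡ-< t s<t)
    -- an odd a = 2s + 1 is 2(s + t + 1) − M
    y+y≡a+M : ∀ s t → suc (s + t) + suc (s + t) ≡ suc (s + s) + suc (t + t)
    y+y≡a+M = solve-∀

  subtract : ∀ {x a} → x < M → a < M → ∃[ y ] y < M × reduce (x + y) ≡ a
  subtract {x} {a} x<M a<M with x ≤? a
  ... | yes x≤a = a ∸ x , ≤-<-trans (m∸n≤m a x) a<M , trans (cong reduce (m+[n∸m]≡n x≤a)) (reduce-id a<M)
  ... | no x≰a  = a + M ∸ x , y<M , trans (cong reduce x+y≡a+M) (reduce-+M a<M)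
    where
    x+y≡a+M : x + (a + M ∸ x) ≡ a + M
    x+y≡a+M = m+[n∸m]≡n (≤-trans (<⇒≤ x<M) (m≤n+m M a))
    y<M : a + M ∸ x < M
    y<M = +-cancelˡ-< x _ _ (subst (_< x + M) (sym x+y≡a+M) (+-monoˡ-< M (≰⇒> x≰a)))

  partner : ∀ {x a} → x ≤ M → a < M → ∃[ y ] y ≤ M × x ≢ y × colour x y ≡ a
  partner {x} x≤M a<M with m≤n⇒m<n∨m≡n x≤M
  partner x≤M a<M | inj₂ refl with halve a<M
  ... | y , y<M , ryy≡a = y , <⇒≤ y<M , (<⇒≢ y<M ∘ sym) , trans (colour-M y) ryy≡a
  partner {x} x≤M a<M | inj₁ x<M with subtract x<M a<M
  ... | y , y<M , rxy≡a with x ≟ y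
  -- x + x ≡ a mod M: then a is the colour of the edge from x to the centre M
  ...   | yes refl = M , ≤-refl , <⇒≢ x<M , trans (colour-x-M (<⇒≢ x<M)) rxy≡a
  ...   | no x≢y   = y , <⇒≤ y<M , x≢y , trans (colour-x-y (<⇒≢ x<M) (<⇒≢ y<M)) rxy≡a

  partnerᵇ : ℕ → ℕ → ℕ → Bool
  partnerᵇ a x y = not (x ≡ᵇ y) ∧ (colour x y ≡ᵇ a)

  partnerᵇ-sound : ∀ {a x y} → T (partnerᵇ a x y) → x ≢ y × colour x y ≡ a
  partnerᵇ-sound {a} {x} {y} p with Equivalence.to T-∧ p
  ... | x≢ᵇy , cxy≡a = (λ { refl → subst (T ∘ not) (≡ᵇ-refl x) x≢ᵇy }) , ≡ᵇ⇒≡ (colour x y) a cxy≡a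

  partnerᵇ-complete : ∀ {a x y} → x ≢ y → colour x y ≡ a → T (partnerᵇ a x y)
  partnerᵇ-complete {a} {x} {y} x≢y refl rewrite ≡ᵇ-≢ x≢y = ≡⇒≡ᵇ (colour x y) _ refl

  partnerᵇ-irrefl : ∀ a x → partnerᵇ a x x ≡ false
  partnerᵇ-irrefl a x rewrite ≡ᵇ-refl x = refl

  partnerᵇ-sym : ∀ a x y → partnerᵇ a x y ≡ partnerᵇ a y x
  partnerᵇ-sym a x y = cong₂ _∧_ (cong not (≡ᵇ-sym x y)) (cong (_≡ᵇ a) (colour-sym x y))

  perfectMatching : ∀ {a x} → a < M → x ≤ M → ∑[ j < suc M ] 𝟙 (partnerᵇ a x (toℕ j)) ≡ 1
  perfectMatching {a} {x} a<M x≤M with partner x≤M a<M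
  ... | y , y≤M , x≢y , cxy≡a =
    count-≡1 _ unique (fromℕ< (s≤s y≤M))
      (subst (T ∘ partnerᵇ a x) (sym (toℕ-fromℕ< (s≤s y≤M))) (partnerᵇ-complete x≢y cxy≡a))
    where
    unique : ∀ j l → T (partnerᵇ a x (toℕ j)) → T (partnerᵇ a x (toℕ l)) → j ≡ l
    unique j l pj pl =
      let (x≢j , cxj≡a) = partnerᵇ-sound pj
          (x≢l , cxl≡a) = partnerᵇ-sound pl
      in toℕ-injective (colour-cancel x≤M (≤-pred (toℕ<n j)) (≤-pred (toℕ<n l)) x≢j x≢l (trans cxj≡a (sym cxl≡a)))

  vertex-≤ : ∀ {n} → n ≤ suc M → (i : Fin n) → toℕ i ≤ M
  vertex-≤ n≤1+M i = ≤-pred (≤-trans (toℕ<n i) n≤1+M)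

  colouring : ∀ {n k} .{{_ : NonZero k}} → n ≤ suc M → (G : Graph n) →
              (∀ i j → Adj G i j → colour (toℕ i) (toℕ j) < k) → ProperEdgeColoring G k
  colouring {n} {k} n≤1+M G below = record
    { c      = c
    ; sym    = λ i j _ → cong (_mod k) (colour-sym (toℕ i) (toℕ j))
    ; proper = λ i j l Aij Ail j≢l cij≡cil →
        j≢l (toℕ-injective (colour-cancel (vertex-≤ n≤1+M i) (vertex-≤ n≤1+M j) (vertex-≤ n≤1+M l)
          (Adj⇒≢ {G = G} Aij) (Adj⇒≢ {G = G} Ail)
          (trans (sym (toℕ-mod (below i j Aij))) (trans (cong toℕ cij≡cil) (toℕ-mod (below i l Ail))))))
    }
    where
    c : Fin n → Fin n → Fin k
    c i j = colour (toℕ i) (toℕ j) mod k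

  discarded : ∀ {n} → ℕ → Graph n
  discarded k i j = not (colour (toℕ i) (toℕ j) <ᵇ k)

  kept⇒colour-< : ∀ {n k} {i j : Fin n} → (K n ─ discarded k) i j ≡ true → colour (toℕ i) (toℕ j) < k
  kept⇒colour-< {k = k} kept = <ᵇ⇒< _ k (Equivalence.from T-≡ (trans (sym (not-involutive _)) kept))

  kept-colouring : ∀ {n k} .{{_ : NonZero k}} → n ≤ suc M → ProperEdgeColoring (K n ─ discarded k) k
  kept-colouring {n} {k} n≤1+M = colouring n≤1+M (K n ─ discarded k) below
    where
    below : ∀ i j → Adj (K n ─ discarded k) i j → colour (toℕ i) (toℕ j) < k
    below i j (inj₁ (_ , kept)) = kept⇒colour-< {i = i} {j} kept
    below i j (inj₂ (_ , kept)) = subst (_< k) (colour-sym (toℕ j) (toℕ i)) (kept⇒colour-< {i = j} {i} kept)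

  K-colouring : ∀ {n k} .{{_ : NonZero k}} → n ≤ suc M → M ≤ k → ProperEdgeColoring (K n) k
  K-colouring {n} n≤1+M M≤k = colouring n≤1+M (K n) λ i j Aij →
    <-≤-trans (colour-< (vertex-≤ n≤1+M i) (vertex-≤ n≤1+M j) (Adj⇒≢ {G = K n} Aij)) M≤k

  degree-kept : ∀ {n} k (i : Fin n) →
                degree (K n ─ discarded k) i ≡ ∑[ a < k ] ∑[ j < n ] 𝟙 (partnerᵇ (toℕ a) (toℕ i) (toℕ j))
  degree-kept {n} k i = begin
    degree (K n ─ discarded k) i
      ≡⟨ sum-cong-≗ {n} (λ j → cong 𝟙 (adjᵇ-symmetric (K n ─ discarded k) kept-sym i j)) ⟩
    ∑[ j < n ] 𝟙 (not (toℕ i ≡ᵇ toℕ j) ∧ not (not (colour (toℕ i) (toℕ j) <ᵇ k)))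
      ≡⟨ sum-cong-≗ {n} (λ j → cong (λ b → 𝟙 (not (toℕ i ≡ᵇ toℕ j) ∧ b)) (not-involutive _)) ⟩
    ∑[ j < n ] 𝟙 (not (toℕ i ≡ᵇ toℕ j) ∧ (colour (toℕ i) (toℕ j) <ᵇ k))
      ≡⟨ sum-cong-≗ {n} (λ j → 𝟙-∧-<ᵇ-split k _ _) ⟩
    ∑[ j < n ] ∑[ a < k ] 𝟙 (partnerᵇ (toℕ a) (toℕ i) (toℕ j))
      ≡⟨ ∑-comm {n} {k} _ ⟩
    ∑[ a < k ] ∑[ j < n ] 𝟙 (partnerᵇ (toℕ a) (toℕ i) (toℕ j)) ∎
    where
    open ≡-Reasoning
    kept-sym : ∀ i j → (K n ─ discarded k) i j ≡ (K n ─ discarded k) j i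
    kept-sym i j = cong (λ c → not (not (c <ᵇ k))) (colour-sym (toℕ i) (toℕ j))

  handshake-kept-even : ∀ {k} → k ≤ M →
    edgeCount (K (suc M) ─ discarded k) + edgeCount (K (suc M) ─ discarded k) ≡ suc M * k
  handshake-kept-even {k} k≤M = begin
    edgeCount G + edgeCount G                                          ≡⟨ handshake G ⟩
    ∑[ i < suc M ] degree G i                                          ≡⟨ sum-cong-≗ {suc M} (degree-kept k) ⟩
    ∑[ i < suc M ] ∑[ a < k ] ∑[ j < suc M ] 𝟙 (partnerᵇ (toℕ a) (toℕ i) (toℕ j))
      ≡⟨ sum-cong-≗ {suc M} (λ i → sum-cong-≗ {k} (λ a →
           perfectMatching (<-≤-trans (toℕ<n a) k≤M) (≤-pred (toℕ<n i)))) ⟩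
    ∑[ i < suc M ] ∑[ a < k ] 1                                        ≡⟨ sum-cong-≗ {suc M} (λ _ → ∑-one k) ⟩
    ∑[ i < suc M ] k                                                   ≡⟨ ∑-const (suc M) k ⟩
    suc M * k                                                          ∎
    where
    open ≡-Reasoning
    G : Graph (suc M)
    G = K (suc M) ─ discarded k

  -- Every colour class of K (M + 1) is a perfect matching, so in K M each colour misses
  -- exactly one vertex: the partner of M.
  handshake-kept-odd : ∀ {k} → k ≤ M →
    edgeCount (K M ─ discarded k) + edgeCount (K M ─ discarded k) + k ≡ M * k
  handshake-kept-odd {k} k≤M = begin
    edgeCount G + edgeCount G + k
      ≡⟨ cong₂ _+_ (handshake G) (sym centre-edges) ⟩
    ∑[ i < M ] degree G i + ∑[ a < k ] ∑[ i < M ] P a (toℕ i) M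
      ≡⟨ cong₂ _+_ (sum-cong-≗ {M} (degree-kept k)) (∑-comm {k} {M} (λ a i → P a (toℕ i) M)) ⟩
    ∑[ i < M ] ∑[ a < k ] ∑[ j < M ] P a (toℕ i) (toℕ j) + ∑[ i < M ] ∑[ a < k ] P a (toℕ i) M
      ≡⟨ sym (∑-distrib-+ {M} (λ i → ∑[ a < k ] ∑[ j < M ] P a (toℕ i) (toℕ j))
                              (λ i → ∑[ a < k ] P a (toℕ i) M)) ⟩
    ∑[ i < M ] (∑[ a < k ] ∑[ j < M ] P a (toℕ i) (toℕ j) + ∑[ a < k ] P a (toℕ i) M)
      ≡⟨ sum-cong-≗ {M} (λ i → sym (∑-distrib-+ {k} (λ a → ∑[ j < M ] P a (toℕ i) (toℕ j))
                                                      (λ a → P a (toℕ i) M))) ⟩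
    ∑[ i < M ] ∑[ a < k ] (∑[ j < M ] P a (toℕ i) (toℕ j) + P a (toℕ i) M)
      ≡⟨ sum-cong-≗ {M} (λ i → sum-cong-≗ {k} (λ a → matched i a)) ⟩
    ∑[ i < M ] ∑[ a < k ] 1
      ≡⟨ sum-cong-≗ {M} (λ _ → ∑-one k) ⟩
    ∑[ i < M ] k
      ≡⟨ ∑-const M k ⟩
    M * k ∎
    where
    open ≡-Reasoning
    G : Graph M
    G = K M ─ discarded k
    P : Fin k → ℕ → ℕ → ℕ
    P a x y = 𝟙 (partnerᵇ (toℕ a) x y)
    a<M : ∀ (a : Fin k) → toℕ a < M
    a<M a = <-≤-trans (toℕ<n a) k≤M
    matched : ∀ (i : Fin M) a → ∑[ j < M ] P a (toℕ i) (toℕ j) + P a (toℕ i) M ≡ 1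
    matched i a = trans (sym (∑-upTo-suc M (P a (toℕ i)))) (perfectMatching (a<M a) (<⇒≤ (toℕ<n i)))
    matched-with-centre : ∀ a → ∑[ i < M ] P a (toℕ i) M ≡ 1
    matched-with-centre a = begin
      ∑[ i < M ] P a (toℕ i) M
        ≡⟨ sum-cong-≗ {M} (λ i → cong 𝟙 (partnerᵇ-sym (toℕ a) (toℕ i) M)) ⟩
      ∑[ i < M ] P a M (toℕ i)
        ≡⟨ sym (+-identityʳ _) ⟩
      ∑[ i < M ] P a M (toℕ i) + 0
        ≡⟨ cong (∑[ i < M ] P a M (toℕ i) +_) (cong 𝟙 (sym (partnerᵇ-irrefl (toℕ a) M))) ⟩
      ∑[ i < M ] P a M (toℕ i) + P a M M
        ≡⟨ sym (∑-upTo-suc M (P a M)) ⟩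
      ∑[ i < suc M ] P a M (toℕ i)
        ≡⟨ perfectMatching (a<M a) ≤-refl ⟩
      1 ∎
    centre-edges : ∑[ a < k ] ∑[ i < M ] P a (toℕ i) M ≡ k
    centre-edges = trans (sum-cong-≗ {k} matched-with-centre) (∑-one k)

  ≤1+M : ∀ {n} → n ≡ M ⊎ n ≡ suc M → n ≤ suc M
  ≤1+M (inj₁ refl) = n≤1+n M
  ≤1+M (inj₂ refl) = ≤-refl

  M≤ : ∀ {n} → n ≡ M ⊎ n ≡ suc M → M ≤ n
  M≤ (inj₁ refl) = ≤-refl
  M≤ (inj₂ refl) = n≤1+n M

  edgeCount-kept : ∀ {n k} → n ≡ M ⊎ n ≡ suc M → k ≤ M → edgeCount (K n ─ discarded k) ≡ (n / 2) * k
  edgeCount-kept {k = k} (inj₁ refl) k≤M = begin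
    edgeCount (K M ─ discarded k) ≡⟨ double-injective (+-cancelʳ-≡ k _ _ (trans (handshake-kept-odd k≤M) (split t k))) ⟩
    t * k                         ≡⟨ cong (_* k) (trans (n≡⌈n+n/2⌉ t) (sym (/2≡⌊/2⌋ M))) ⟩
    (M / 2) * k                   ∎
    where
    open ≡-Reasoning
    split : ∀ t k → suc (t + t) * k ≡ t * k + t * k + k
    split = solve-∀
  edgeCount-kept {k = k} (inj₂ refl) k≤M = begin
    edgeCount (K (suc M) ─ discarded k) ≡⟨ double-injective (trans (handshake-kept-even k≤M) (split t k)) ⟩
    suc t * k                           ≡⟨ cong (_* k) (trans (cong suc (n≡⌊n+n/2⌋ t)) (sym (/2≡⌊/2⌋ (suc M)))) ⟩
    (suc M / 2) * k                     ∎
    where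
    open ≡-Reasoning
    split : ∀ t k → suc (suc (t + t)) * k ≡ suc t * k + suc t * k
    split = solve-∀

  edgeCount-discarded : ∀ {n k} → n ≡ M ⊎ n ≡ suc M → k ≤ M → edgeCount (discarded {n} k) ≡ n C 2 ∸ (n / 2) * k
  edgeCount-discarded {n} {k} n≡M⊎n≡1+M k≤M = begin
    edgeCount D
      ≡⟨ sym (m+n∸n≡m (edgeCount D) (edgeCount (K n ─ D))) ⟩
    edgeCount D + edgeCount (K n ─ D) ∸ edgeCount (K n ─ D)
      ≡⟨ cong₂ _∸_ (edgeCount-complement D) (edgeCount-kept n≡M⊎n≡1+M k≤M) ⟩
    n C 2 ∸ (n / 2) * k ∎
    where
    open ≡-Reasoning
    D : Graph n
    D = discarded k

mainTheorem13 : (n k : ℕ) → 1 ≤ k → k ≤ n →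
    (n ≤ k → LambdaE≡ (K n) k 0)
    × (k < n → LambdaE≡ (K n) k ((n C 2) ∸ (n / 2) * k))
mainTheorem13 n k@(suc _) 1≤k k≤n with odd-or-even (≤-trans 1≤k k≤n)
... | t , n≡M⊎n≡1+M = nothingToRemove , removeDiscarded
  where
  open RoundRobin t
  n≤1+M : n ≤ suc M
  n≤1+M = ≤1+M n≡M⊎n≡1+M
  nothingToRemove : n ≤ k → LambdaE≡ (K n) k 0
  nothingToRemove n≤k =
    ((λ _ _ → false) , ((λ _ _ ()) , K-colouring n≤1+M (≤-trans (M≤ n≡M⊎n≡1+M) n≤k)) , edgeCount-empty n)
    , λ _ _ → z≤n
  removeDiscarded : k < n → LambdaE≡ (K n) k ((n C 2) ∸ (n / 2) * k)
  removeDiscarded k<n =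
    (discarded k , ((λ _ _ e → proj₁ e , refl) , kept-colouring n≤1+M) , edgeCount-discarded n≡M⊎n≡1+M k≤M)
    , removalSet-size-≥
    where
    k≤M : k ≤ M
    k≤M = ≤-pred (≤-trans k<n n≤1+M)
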